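{- Let $t\in\mathbb{N}$, let $G$ be a $K_{t,t}$-free graph, let $\mathcal{P}$ be a partition of $V(G)$, and let $H$ be a $\mathcal{P}$-flip of $G$. Then $$\operatorname{dist}_H(u,v)\le 3\qquad\text{for all edges } uv\in E\big(G\setminus \mathsf{Sparsify}(G,\mathcal{P},t)\big).$$
   Context: Graphs are finite, simple, undirected. $K_{t,t}$-free means no subgraph isomorphic to $K_{t,t}$. $G\setminus S$ denotes deletion of the vertex set $S$. For $A,B\subseteq V(G)$, flipping $(A,B)$ in $G$ yields the graph on $V(G)$ whose edge set (on pairs of distinct vertices) is $E(G)\,\triangle\,\{ab:a\in A,b\in B\}$; a $\mathcal{P}$-flip of $G$ is obtained by flipping some pairs $(A,B)$ with $A,B\in\mathcal{P}$ (possibly $A=B$). A set $P\subseteq V(G)$ is $t$-small if $|P|<t^2$ and $t$-big otherwise. A vertex $v$ is $t$-complete to $P$ in $G$ if $|P\setminus N_G(v)|<t$, where $N_G(v)$ is the open neighborhood. $\mathsf{Sparsify}(G,\mathcal{P},t)$ is the set of vertices $v\in V(G)$ that either lie in a $t$-small part of $\mathcal{P}$ or are $t$-complete to at least one $t$-big part of $\mathcal{P}$. -}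

module Defs where

open import Data.Nat using (ℕ; zero; suc; _+_; _*_; _<_; _≤_; _≥_)
open import Data.Fin using (Fin; zero; suc; _≟_)
open import Data.Bool using (Bool; true; false; if_then_else_; _∧_; _∨_; _xor_; not)
open import Data.List using (List; foldr)
open import Data.Product using (_×_; _,_; Σ; ∃; ∃-syntax)
open import Data.Sum using (_⊎_)
open import Relation.Nullary using (¬_)
open import Relation.Nullary.Decidable using (⌊_⌋)
open import Relation.Binary.PropositionalEquality using (_≡_; _≢_)
open import Function.Definitions using (Injective)

record Graph (n : ℕ) : Set where
  field
    adj    : Fin n → Fin n → Bool
    sym    : ∀ u v → adj u v ≡ adj v u
    irrefl : ∀ v → adj v v ≡ false
open Graph public

count : ∀ {n} → (Fin n → Bool) → ℕ
count {zero}  f = 0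
count {suc n} f = (if f zero then 1 else 0) + count (λ i → f (suc i))

KttFree : ∀ {n} → ℕ → Graph n → Set
KttFree {n} t G =
  ¬ (Σ (Fin t → Fin n) λ f → Σ (Fin t → Fin n) λ g →
       Injective _≡_ _≡_ f × Injective _≡_ _≡_ g ×
       (∀ i j → f i ≢ g j) × (∀ i j → adj G (f i) (g j) ≡ true))

-- A partition of V(G) = Fin n is given by a labelling p : Fin n → Fin k;
-- the parts are the fibres p⁻¹(i).
inPart : ∀ {n k} → (Fin n → Fin k) → Fin k → Fin n → Bool
inPart p i w = ⌊ p w ≟ i ⌋

partSize : ∀ {n k} → (Fin n → Fin k) → Fin k → ℕ
partSize p i = count (inPart p i)

Small : ∀ {n k} → ℕ → (Fin n → Fin k) → Fin k → Set
Small t p i = partSize p i < t * t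

Big : ∀ {n k} → ℕ → (Fin n → Fin k) → Fin k → Set
Big t p i = partSize p i ≥ t * t

TComplete : ∀ {n k} → ℕ → Graph n → (Fin n → Fin k) → Fin n → Fin k → Set
TComplete t G p v i = count (λ w → inPart p i w ∧ not (adj G v w)) < t

Sparsify : ∀ {n k} → Graph n → (Fin n → Fin k) → ℕ → Fin n → Set
Sparsify G p t v =
  Small t p (p v) ⊎ (∃[ i ] (Big t p i × TComplete t G p v i))

-- Flipping a list of pairs (A_i, B_j) of parts, performed sequentially;
-- each flip toggles uv (u ≠ v) iff (u ∈ A ∧ v ∈ B) ∨ (u ∈ B ∧ v ∈ A).
hits : ∀ {n k} → (Fin n → Fin k) → Fin k × Fin k → Fin n → Fin n → Bool
hits p (i , j) u v = (inPart p i u ∧ inPart p j v) ∨ (inPart p j u ∧ inPart p i v)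

flipAdj : ∀ {n k} → Graph n → (Fin n → Fin k) → List (Fin k × Fin k) →
          Fin n → Fin n → Bool
flipAdj G p F u v =
  not ⌊ u ≟ v ⌋ ∧ foldr (λ q b → hits p q u v xor b) (adj G u v) F

data Walk {n : ℕ} (A : Fin n → Fin n → Bool) : Fin n → Fin n → ℕ → Set where
  here : ∀ {u} → Walk A u u 0
  step : ∀ {u w v m} → A u w ≡ true → Walk A w v m → Walk A u v (suc m)

DistLe : ∀ {n} → (Fin n → Fin n → Bool) → ℕ → Fin n → Fin n → Set
DistLe A d u v = ∃[ m ] (m ≤ d × Walk A u v m)

-- If uv is still an edge of H we are done. Otherwise the pair of parts (P_u, P_v) was
-- flipped, so in H every G-non-edge between P_u and P_v becomes an edge. Since neither u
-- nor v is sparsified, both parts are t-big, u has at least t non-neighbours a in P_v and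
-- v has at least t non-neighbours b in P_u; K_{t,t}-freeness yields such a and b that are
-- non-adjacent in G, and u – a – b – v is a walk of length at most 3 in H.
module Submission where

open import Defs hiding (sym)
open import Data.Nat using (ℕ; zero; suc; _+_; _≤_; z≤n; s≤s)
open import Data.Nat.Properties using (≮⇒≥; +-mono-≤)
open import Data.Fin using (Fin; zero; suc; _≟_)
open import Data.Fin.Properties using (any?; suc-injective)
open import Data.Bool using (Bool; true; false; _∧_; _∨_; _xor_; not)
import Data.Bool as Bool
open import Data.Bool.Properties
  using (∧-comm; ∨-comm; ∧-conicalˡ; ∧-conicalʳ; ¬-not; not-¬; not-injective; T-≡;
         xor-assoc; xor-comm; xor-identityʳ)
open import Data.List using (List; []; _∷_; foldr)
open import Data.Product using (_×_; _,_; Σ; ∃-syntax)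
open import Data.Sum using (inj₁; inj₂)
open import Function using (_∘_)
open import Function.Bundles using (Equivalence)
open import Function.Definitions using (Injective)
open import Relation.Nullary using (¬_; yes; no; contradiction)
open import Relation.Nullary.Decidable using (⌊_⌋; _×-dec_; toWitness; isYes≗does; dec-false)
open import Relation.Binary.PropositionalEquality
  using (_≡_; _≢_; refl; sym; trans; cong; cong₂; subst; module ≡-Reasoning)

count⇒injection : ∀ {n} (P : Fin n → Bool) {t} → t ≤ count P →
                  Σ (Fin t → Fin n) λ f → Injective _≡_ _≡_ f × (∀ i → P (f i) ≡ true)
count⇒injection P {zero} _ = (λ ()) , (λ { {()} }) , λ ()
count⇒injection {zero} P {suc t} ()
count⇒injection {suc n} P {suc t} t≤ with P zero in P0
... | false with count⇒injection (P ∘ suc) t≤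
...   | f , f-inj , Pf = suc ∘ f , f-inj ∘ suc-injective , Pf
count⇒injection {suc n} P {suc t} (s≤s t≤) | true with count⇒injection (P ∘ suc) t≤
...   | f , f-inj , Pf = g , g-inj , Pg
  where
  g : Fin (suc t) → Fin (suc n)
  g zero    = zero
  g (suc i) = suc (f i)
  g-inj : Injective _≡_ _≡_ g
  g-inj {zero}  {zero}  _ = refl
  g-inj {suc i} {suc j} e = cong suc (f-inj (suc-injective e))
  Pg : ∀ i → P (g i) ≡ true
  Pg zero    = P0
  Pg (suc i) = Pf i

module _ {n : ℕ} where

  Walk-++ : ∀ {A : Fin n → Fin n → Bool} {x y z l m} →
            Walk A x y l → Walk A y z m → Walk A x z (l + m)
  Walk-++ here         q = q
  Walk-++ (step e w) q = step e (Walk-++ w q)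

  DistLe-trans : ∀ {A : Fin n → Fin n → Bool} {l m x y z} →
                 DistLe A l x y → DistLe A m y z → DistLe A (l + m) x z
  DistLe-trans (i , i≤l , w) (j , j≤m , w′) = i + j , +-mono-≤ i≤l j≤m , Walk-++ w w′

  KttFree⇒nonadjacent-pair :
    ∀ {t} (G : Graph n) → KttFree t G → (A B : Fin n → Bool) →
    t ≤ count A → t ≤ count B →
    ∃[ a ] ∃[ b ] (A a ≡ true × B b ≡ true × adj G a b ≡ false)
  KttFree⇒nonadjacent-pair G free A B tA tB
    with any? (λ a → any? (λ b → A a Bool.≟ true ×-dec B b Bool.≟ true ×-dec adj G a b Bool.≟ false))
  ... | yes pair = pair
  ... | no ¬pair with count⇒injection A tA | count⇒injection B tB
  ... | f , f-inj , Af | g , g-inj , Bg =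
    contradiction (f , g , (λ {_ _} → f-inj) , (λ {_ _} → g-inj) , disjoint , complete) free
    where
    disjoint : ∀ i j → f i ≢ g j
    disjoint i j fi≡gj =
      ¬pair (f i , f i , Af i , subst (λ w → B w ≡ true) (sym fi≡gj) (Bg j) , irrefl G (f i))
    complete : ∀ i j → adj G (f i) (g j) ≡ true
    complete i j = ¬-not λ nonadj → ¬pair (f i , g j , Af i , Bg j , nonadj)

foldr-xor : ∀ {A : Set} (h : A → Bool) (xs : List A) c →
            foldr (λ q b → h q xor b) c xs ≡ c xor foldr (λ q b → h q xor b) false xs
foldr-xor h []       c = sym (xor-identityʳ c)
foldr-xor h (q ∷ xs) c = begin
  h q xor foldr _ c xs        ≡⟨ cong (h q xor_) (foldr-xor h xs c) ⟩
  h q xor (c xor r)           ≡⟨ sym (xor-assoc (h q) c r) ⟩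
  (h q xor c) xor r           ≡⟨ cong (_xor r) (xor-comm (h q) c) ⟩
  (c xor h q) xor r           ≡⟨ xor-assoc c (h q) r ⟩
  c xor (h q xor r)           ∎
  where
  open ≡-Reasoning
  r = foldr (λ q b → h q xor b) false xs

module _ {k : ℕ} where

  -- Whether the pair of parts (i, j) is toggled by F; hits p q x y is definitionally
  -- hits (λ a → a) q (p x) (p y).
  flipped : List (Fin k × Fin k) → Fin k → Fin k → Bool
  flipped F i j = foldr (λ q b → hits (λ a → a) q i j xor b) false F

  hits-sym : ∀ {n} (p : Fin n → Fin k) q x y → hits p q x y ≡ hits p q y x
  hits-sym p (i , j) x y =
    trans (∨-comm (inPart p i x ∧ inPart p j y) (inPart p j x ∧ inPart p i y))
          (cong₂ _∨_ (∧-comm (inPart p j x) (inPart p i y)) (∧-comm (inPart p i x) (inPart p j y)))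

  flipped-sym : ∀ F i j → flipped F i j ≡ flipped F j i
  flipped-sym []      i j = refl
  flipped-sym (q ∷ F) i j = cong₂ _xor_ (hits-sym (λ a → a) q i j) (flipped-sym F i j)

  module _ {n : ℕ} (G : Graph n) (p : Fin n → Fin k) (F : List (Fin k × Fin k)) where

    flipAdj-≢ : ∀ {x y} → x ≢ y → flipAdj G p F x y ≡ adj G x y xor flipped F (p x) (p y)
    flipAdj-≢ {x} {y} x≢y = begin
      not ⌊ x ≟ y ⌋ ∧ toggled (adj G x y)   ≡⟨ cong (λ b → not b ∧ toggled (adj G x y)) x≟y-false ⟩
      toggled (adj G x y)                   ≡⟨ foldr-xor (λ q → hits p q x y) F (adj G x y) ⟩
      adj G x y xor flipped F (p x) (p y)   ∎
      where
      open ≡-Reasoning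
      toggled : Bool → Bool
      toggled c = foldr (λ q b → hits p q x y xor b) c F
      x≟y-false : ⌊ x ≟ y ⌋ ≡ false
      x≟y-false = trans (isYes≗does (x ≟ y)) (dec-false (x ≟ y) x≢y)

    unflipped-edge : ∀ {x y} → flipped F (p x) (p y) ≡ false → adj G x y ≡ true →
                     flipAdj G p F x y ≡ true
    unflipped-edge {x} {y} unflipped xy = begin
      flipAdj G p F x y                     ≡⟨ flipAdj-≢ x≢y ⟩
      adj G x y xor flipped F (p x) (p y)   ≡⟨ cong₂ _xor_ xy unflipped ⟩
      true                                  ∎
      where
      open ≡-Reasoning
      x≢y : x ≢ y
      x≢y refl = not-¬ xy (irrefl G x)

    flipped-nonedge : ∀ {i j x y} → flipped F i j ≡ true → p x ≡ i → p y ≡ j →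
                      adj G x y ≡ false → DistLe (flipAdj G p F) 1 x y
    flipped-nonedge {x = x} {y} ij refl refl xy with x ≟ y
    ... | yes refl = 0 , z≤n , here
    ... | no x≢y   = 1 , s≤s z≤n , step (trans (flipAdj-≢ x≢y) (cong₂ _xor_ xy ij)) here

module _ {n k : ℕ} (G : Graph n) (p : Fin n → Fin k) where

  nonNeighboursIn : Fin n → Fin k → Fin n → Bool
  nonNeighboursIn v i w = inPart p i w ∧ not (adj G v w)

  nonNeighboursIn-true : ∀ {v i w} → nonNeighboursIn v i w ≡ true →
                         p w ≡ i × adj G v w ≡ false
  nonNeighboursIn-true {v} {i} {w} e =
    toWitness {a? = p w ≟ i} (Equivalence.from T-≡ (∧-conicalˡ (inPart p i w) _ e)) ,
    not-injective (∧-conicalʳ (inPart p i w) _ e)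

  module _ {t : ℕ} {v : Fin n} (¬sparse : ¬ Sparsify G p t v) where

    ¬Sparsify⇒Big : Big t p (p v)
    ¬Sparsify⇒Big = ≮⇒≥ (¬sparse ∘ inj₁)

    ¬Sparsify⇒nonNeighbours : ∀ {i} → Big t p i → t ≤ count (nonNeighboursIn v i)
    ¬Sparsify⇒nonNeighbours {i} big = ≮⇒≥ λ few → ¬sparse (inj₂ (i , big , few))

lemma3p4 : (t n k : ℕ) (G : Graph n) → KttFree t G →
    (p : Fin n → Fin k) (F : List (Fin k × Fin k)) →
    (u v : Fin n) → adj G u v ≡ true →
    ¬ Sparsify G p t u → ¬ Sparsify G p t v →
    DistLe (flipAdj G p F) 3 u v
lemma3p4 t n k G free p F u v uv ¬su ¬sv with flipped F (p u) (p v) in uv-flipped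
... | false = 1 , s≤s z≤n , step (unflipped-edge G p F uv-flipped uv) here
... | true
  with KttFree⇒nonadjacent-pair G free (nonNeighboursIn G p u (p v)) (nonNeighboursIn G p v (p u))
         (¬Sparsify⇒nonNeighbours G p ¬su (¬Sparsify⇒Big G p ¬sv))
         (¬Sparsify⇒nonNeighbours G p ¬sv (¬Sparsify⇒Big G p ¬su))
... | a , b , a∈ , b∈ , ab
  with nonNeighboursIn-true G p a∈ | nonNeighboursIn-true G p b∈
... | pa , ua | pb , vb =
  DistLe-trans (DistLe-trans
    (flipped-nonedge G p F uv-flipped refl pa ua)
    (flipped-nonedge G p F (trans (flipped-sym F (p v) (p u)) uv-flipped) pa pb ab))
    (flipped-nonedge G p F uv-flipped pb refl (trans (Graph.sym G b v) vb))
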